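{- For any integer $k\ge 3$ and constant $\gamma>0$ there exists $n_0$ such that the following holds. Let $H$ be an $n$-vertex $k$-uniform hypergraph with $n\ge n_0$ and $\delta_{k-1}(H)\ge \frac{n}{k}-\gamma n$. If $H$ is not $2k\gamma$-extremal, then $H$ contains a matching that covers all but at most $k^2/\gamma$ vertices.
   Context: A $k$-uniform hypergraph $H$ has vertex set $V(H)$ and edge set $E(H)\subseteq\binom{V(H)}{k}$. A matching is a collection of pairwise vertex-disjoint edges. $\delta_{k-1}(H)$ is the minimum, over all $(k-1)$-sets $S$ of vertices, of the number of edges containing $S$. A set of vertices is independent if it contains no edge of $H$. For $\beta>0$, an $n$-vertex $k$-graph $H$ is $\beta$-extremal if $V(H)$ contains an independent set of size at least $(1-\beta)\frac{k-1}{k}n$. No divisibility assumption on $n$ is made.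
   Formalization: The constant γ ranges only over the positive rationals. -}

module Defs where

open import Data.Nat using (ℕ; zero; suc; _∸_; _≤_)
open import Data.Bool using (Bool; true; false)
open import Data.Fin using (Fin)
open import Data.Fin.Subset using (Subset; _⊆_; ∣_∣; _∩_; Empty; ⋃; inside; outside)
open import Data.Vec using (_∷_; [])
open import Data.List using (List; []; _∷_; map; _++_; length; filter)
open import Data.List.Relation.Unary.All using (All)
open import Data.List.Relation.Unary.AllPairs using (AllPairs)
open import Data.Product using (Σ; _×_; _,_)
open import Relation.Binary.PropositionalEquality using (_≡_)
open import Relation.Nullary using (¬_)
open import Data.Fin.Subset.Properties using (_⊆?_)
open import Data.Rational using (ℚ; _/_)
open import Data.Integer using (+_)

record Hypergraph (k n : ℕ) : Set where
  field
    isEdge  : Subset n → Bool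
    uniform : ∀ e → isEdge e ≡ true → ∣ e ∣ ≡ k
open Hypergraph public

allSubsets : (n : ℕ) → List (Subset n)
allSubsets zero    = [] ∷ []
allSubsets (suc n) = map (inside ∷_) (allSubsets n) ++ map (outside ∷_) (allSubsets n)

edges : ∀ {k n} → Hypergraph k n → List (Subset n)
edges {n = n} H = filter (λ e → Data.Bool._≟_ (isEdge H e) true) (allSubsets n)
  where import Data.Bool

deg : ∀ {k n} → Hypergraph k n → Subset n → ℕ
deg H S = length (filter (λ e → S ⊆? e) (edges H))

ℕ→ℚ : ℕ → ℚ
ℕ→ℚ m = + m / 1

Independent : ∀ {k n} → Hypergraph k n → Subset n → Set
Independent H I = ∀ e → isEdge H e ≡ true → ¬ (e ⊆ I)

IsMatching : ∀ {k n} → Hypergraph k n → List (Subset n) → Set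
IsMatching H M = All (λ e → isEdge H e ≡ true) M × AllPairs (λ e f → Empty (e ∩ f)) M

uncovered : ∀ {n} → List (Subset n) → ℕ
uncovered {n} M = n ∸ ∣ ⋃ M ∣

-- Let M be a matching with uncovered set U, and suppose γ|U| > k². Split U into m ≥ k/γ disjoint
-- (k−1)-sets S and call a vertex v heavy if S ∪ {v} is an edge for at least k of them; let B be the
-- set of heavy vertices. Counting pairs (S, v) with S ∪ {v} ∈ H, the codegree condition gives
-- m(n/k − γn) ≤ Σ deg(S) ≤ m|B| + kn, so |B| ≥ n/k − 2γn. If an edge of M contains two heavy
-- vertices, or some edge lies inside I = U ∪ (W ∖ B), where W is the union of the edges of M meeting
-- B, then M can be enlarged: start from a new edge f and repeatedly trade an edge e of M meeting f
-- for S ∪ {v}, with v ∈ e heavy and S an unused set; heaviness guarantees that unused sets remain.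
-- Otherwise I is independent and, every edge of M having at most one heavy vertex, |I| ≥ (k−1)|B|,
-- so H would be 2kγ-extremal. Since a matching has at most n edges, after finitely many
-- enlargements γ|U| ≤ k². Writing γ = p/q turns every inequality into one between natural numbers.

module Submission where

module Matchings where

  open import Defs
  open import Data.Bool using (Bool; true; false; T)
  import Data.Bool as Bool
  open import Data.Bool.Properties using (T-≡)
  open import Data.Empty using (⊥-elim)
  open import Data.Fin using (Fin; zero; suc)
  open import Data.Fin.Subset
  open import Data.Fin.Subset.Properties
  open import Data.List using (List; []; _∷_; _++_; map; length; filter)
  open import Data.List.Membership.Propositional using (find) renaming (_∈_ to _∈ₗ_)
  open import Data.List.Membership.Propositional.Properties using (∈-filter⁺; ∈-filter⁻)
  open import Data.List.Relation.Unary.All as All using (All; []; _∷_)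
  open import Data.List.Relation.Unary.AllPairs as AllPairs using (AllPairs; []; _∷_)
  import Data.List.Relation.Unary.AllPairs.Properties as AllPairs
  open import Data.List.Relation.Unary.Any as Any using (Any; here; there; any?)
  open import Data.Nat using (ℕ; zero; suc; _+_; _*_; _∸_; _≤_; _<_; z≤n; s≤s; _≤?_; _≤ᵇ_)
  open import Data.Nat.DivMod using (_/_; _%_; m≡m%n+[m/n]*n; m%n<n; m/n*n≤m)
  open import Data.Nat.Properties
  open import Data.Nat.Solver using (module +-*-Solver)
  open +-*-Solver using (solve; _:+_; _:*_; _:=_; con)
  open import Data.Product using (Σ; ∃; _×_; _,_; proj₁; proj₂)
  open import Data.Sum using (_⊎_; inj₁; inj₂)
  open import Data.Vec using ([]; _∷_; here; there; tabulate)
  open import Data.Vec.Properties using (lookup⇒[]=; []=⇒lookup; lookup∘tabulate)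
  open import Function using (_∘_; _⇔_; mk⇔; Equivalence; case_of_)
  open import Relation.Binary.PropositionalEquality
  open import Relation.Nullary using (¬_; Dec; yes; no; does; ¬?)
  open import Relation.Nullary.Decidable using (_×-dec_)

  private variable
    n : ℕ
    A C : Set
    p q : Subset n
    x : Fin n

  Disjoint : Subset n → Subset n → Set
  Disjoint p q = Empty (p ∩ q)

  ∣p∪q∣+∣p∩q∣≡∣p∣+∣q∣ : (p q : Subset n) → ∣ p ∪ q ∣ + ∣ p ∩ q ∣ ≡ ∣ p ∣ + ∣ q ∣
  ∣p∪q∣+∣p∩q∣≡∣p∣+∣q∣ [] [] = refl
  ∣p∪q∣+∣p∩q∣≡∣p∣+∣q∣ (true ∷ p) (true ∷ q) =
    cong suc (trans (+-suc _ _) (trans (cong suc (∣p∪q∣+∣p∩q∣≡∣p∣+∣q∣ p q)) (sym (+-suc _ _))))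
  ∣p∪q∣+∣p∩q∣≡∣p∣+∣q∣ (true ∷ p) (false ∷ q) = cong suc (∣p∪q∣+∣p∩q∣≡∣p∣+∣q∣ p q)
  ∣p∪q∣+∣p∩q∣≡∣p∣+∣q∣ (false ∷ p) (true ∷ q) = trans (cong suc (∣p∪q∣+∣p∩q∣≡∣p∣+∣q∣ p q)) (sym (+-suc _ _))
  ∣p∪q∣+∣p∩q∣≡∣p∣+∣q∣ (false ∷ p) (false ∷ q) = ∣p∪q∣+∣p∩q∣≡∣p∣+∣q∣ p q

  Empty⇒∣p∣≡0 : Empty p → ∣ p ∣ ≡ 0
  Empty⇒∣p∣≡0 {n} e = trans (cong ∣_∣ (Empty-unique e)) (∣⊥∣≡0 n)

  disjoint⇒∣p∪q∣≡∣p∣+∣q∣ : (p q : Subset n) → Disjoint p q → ∣ p ∪ q ∣ ≡ ∣ p ∣ + ∣ q ∣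
  disjoint⇒∣p∪q∣≡∣p∣+∣q∣ p q e = begin
    ∣ p ∪ q ∣               ≡⟨ sym (+-identityʳ _) ⟩
    ∣ p ∪ q ∣ + 0           ≡⟨ cong (∣ p ∪ q ∣ +_) (sym (Empty⇒∣p∣≡0 e)) ⟩
    ∣ p ∪ q ∣ + ∣ p ∩ q ∣   ≡⟨ ∣p∪q∣+∣p∩q∣≡∣p∣+∣q∣ p q ⟩
    ∣ p ∣ + ∣ q ∣           ∎
    where open ≡-Reasoning

  ∣p∩q∣+∣p∩∁q∣≡∣p∣ : (p q : Subset n) → ∣ p ∩ q ∣ + ∣ p ∩ ∁ q ∣ ≡ ∣ p ∣
  ∣p∩q∣+∣p∩∁q∣≡∣p∣ [] [] = refl
  ∣p∩q∣+∣p∩∁q∣≡∣p∣ (true ∷ p) (true ∷ q) = cong suc (∣p∩q∣+∣p∩∁q∣≡∣p∣ p q)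
  ∣p∩q∣+∣p∩∁q∣≡∣p∣ (true ∷ p) (false ∷ q) = trans (+-suc _ _) (cong suc (∣p∩q∣+∣p∩∁q∣≡∣p∣ p q))
  ∣p∩q∣+∣p∩∁q∣≡∣p∣ (false ∷ p) (_ ∷ q) = ∣p∩q∣+∣p∩∁q∣≡∣p∣ p q

  Nonempty⇒1≤∣p∣ : Nonempty p → 1 ≤ ∣ p ∣
  Nonempty⇒1≤∣p∣ {p = p} (x , x∈p) =
    subst (_≤ ∣ p ∣) (∣⁅x⁆∣≡1 x) (p⊆q⇒∣p∣≤∣q∣ λ y∈⁅x⁆ → subst (_∈ p) (sym (x∈⁅y⁆⇒x≡y x y∈⁅x⁆)) x∈p)

  1≤∣p∣⇒Nonempty : (p : Subset n) → 1 ≤ ∣ p ∣ → Nonempty p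
  1≤∣p∣⇒Nonempty (true ∷ p) _ = zero , here
  1≤∣p∣⇒Nonempty (false ∷ p) h with 1≤∣p∣⇒Nonempty p h
  ... | x , x∈p = suc x , there x∈p

  2≤∣p∣⇒distinct-members : (p : Subset n) → 2 ≤ ∣ p ∣ → ∃ λ x → ∃ λ y → x ∈ p × y ∈ p × x ≢ y
  2≤∣p∣⇒distinct-members (true ∷ p) (s≤s h) with 1≤∣p∣⇒Nonempty p h
  ... | y , y∈p = zero , suc y , here , there y∈p , λ ()
  2≤∣p∣⇒distinct-members (false ∷ p) h with 2≤∣p∣⇒distinct-members p h
  ... | x , y , x∈p , y∈p , x≢y = suc x , suc y , there x∈p , there y∈p , x≢y ∘ Data.Fin.Properties.suc-injective
    where import Data.Fin.Properties

  ∈p∪⁅y⁆⁻ : (p : Subset n) (y : Fin n) → x ∈ p ∪ ⁅ y ⁆ → x ∈ p ⊎ x ≡ y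
  ∈p∪⁅y⁆⁻ p y x∈p∪y with x∈p∪q⁻ p ⁅ y ⁆ x∈p∪y
  ... | inj₁ x∈p = inj₁ x∈p
  ... | inj₂ x∈y = inj₂ (x∈⁅y⁆⇒x≡y y x∈y)

  disjoint⁺ : (∀ {x} → x ∈ p → ¬ x ∈ q) → Disjoint p q
  disjoint⁺ {p = p} {q} f (x , x∈p∩q) = f (p∩q⊆p p q x∈p∩q) (p∩q⊆q p q x∈p∩q)

  disjoint⁻ : Disjoint p q → x ∈ p → ¬ x ∈ q
  disjoint⁻ e x∈p x∈q = e (_ , x∈p∩q⁺ (x∈p , x∈q))

  disjoint-sym : Disjoint p q → Disjoint q p
  disjoint-sym e = disjoint⁺ λ x∈q x∈p → disjoint⁻ e x∈p x∈q

  split-off : (X : Subset n) (j : ℕ) → j ≤ ∣ X ∣ →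
              ∃ λ Y → ∃ λ Z → ∣ Y ∣ ≡ j × ∣ Z ∣ + j ≡ ∣ X ∣ × Y ⊆ X × Z ⊆ X × Disjoint Y Z
  split-off {n} X zero _ = ⊥ , X , ∣⊥∣≡0 n , +-identityʳ ∣ X ∣ , ⊥⊆ , ⊆-refl , λ (_ , x∈⊥∩X) → ∉⊥ (p∩q⊆p ⊥ X x∈⊥∩X)
  split-off (true ∷ X) (suc j) (s≤s j≤∣X∣) with split-off X j j≤∣X∣
  ... | Y , Z , ∣Y∣≡j , ∣Z∣+j≡∣X∣ , Y⊆X , Z⊆X , Y∩Z≡∅ =
    inside ∷ Y , outside ∷ Z , cong suc ∣Y∣≡j , trans (+-suc _ _) (cong suc ∣Z∣+j≡∣X∣) ,
    s⊆s Y⊆X , out⊆ Z⊆X , λ { (zero , ()) ; (suc x , there x∈Y∩Z) → Y∩Z≡∅ (x , x∈Y∩Z) }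
  split-off (false ∷ X) (suc j) j≤∣X∣ with split-off X (suc j) j≤∣X∣
  ... | Y , Z , ∣Y∣≡j , ∣Z∣+j≡∣X∣ , Y⊆X , Z⊆X , Y∩Z≡∅ =
    outside ∷ Y , outside ∷ Z , ∣Y∣≡j , ∣Z∣+j≡∣X∣ ,
    s⊆s Y⊆X , s⊆s Z⊆X , λ { (zero , ()) ; (suc x , there x∈Y∩Z) → Y∩Z≡∅ (x , x∈Y∩Z) }

  PairwiseDisjoint : List (Subset n) → Set
  PairwiseDisjoint = AllPairs Disjoint

  ∈⋃⁺ : ∀ {S} {Ss : List (Subset n)} → S ∈ₗ Ss → x ∈ S → x ∈ ⋃ Ss
  ∈⋃⁺ {Ss = S ∷ Ss} (here refl) x∈S = p⊆p∪q (⋃ Ss) x∈S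
  ∈⋃⁺ {Ss = S ∷ Ss} (there S∈Ss) x∈S = q⊆p∪q S (⋃ Ss) (∈⋃⁺ S∈Ss x∈S)

  ∈⋃⁻ : (Ss : List (Subset n)) → x ∈ ⋃ Ss → Any (x ∈_) Ss
  ∈⋃⁻ [] x∈⊥ = ⊥-elim (∉⊥ x∈⊥)
  ∈⋃⁻ (S ∷ Ss) x∈⋃ with x∈p∪q⁻ S (⋃ Ss) x∈⋃
  ... | inj₁ x∈S = here x∈S
  ... | inj₂ x∈⋃Ss = there (∈⋃⁻ Ss x∈⋃Ss)

  disjoint-⋃ : {Ss : List (Subset n)} → All (Disjoint p) Ss → Disjoint p (⋃ Ss)
  disjoint-⋃ {Ss = Ss} p∩Ss≡∅ = disjoint⁺ λ x∈p x∈⋃Ss →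
    let (_ , S∈Ss , x∈S) = find (∈⋃⁻ Ss x∈⋃Ss) in disjoint⁻ (All.lookup p∩Ss≡∅ S∈Ss) x∈p x∈S

  disjoint-⋃⁻ : {p : Subset n} {Ss : List (Subset n)} → Disjoint p (⋃ Ss) → All (Disjoint p) Ss
  disjoint-⋃⁻ p∩⋃Ss≡∅ = All.tabulate λ S∈Ss → disjoint⁺ λ x∈p x∈S → disjoint⁻ p∩⋃Ss≡∅ x∈p (∈⋃⁺ S∈Ss x∈S)

  disjoint-members-equal : ∀ {Ss S S′} → PairwiseDisjoint {n} Ss → S ∈ₗ Ss → S′ ∈ₗ Ss → x ∈ S → x ∈ S′ → S ≡ S′
  disjoint-members-equal _ (here refl) (here refl) _ _ = refl
  disjoint-members-equal (S∩Ss≡∅ ∷ _) (here refl) (there S′∈Ss) x∈S x∈S′ =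
    ⊥-elim (disjoint⁻ (All.lookup S∩Ss≡∅ S′∈Ss) x∈S x∈S′)
  disjoint-members-equal (S′∩Ss≡∅ ∷ _) (there S∈Ss) (here refl) x∈S x∈S′ =
    ⊥-elim (disjoint⁻ (All.lookup S′∩Ss≡∅ S∈Ss) x∈S′ x∈S)
  disjoint-members-equal (_ ∷ disjoint) (there S∈Ss) (there S′∈Ss) x∈S x∈S′ =
    disjoint-members-equal disjoint S∈Ss S′∈Ss x∈S x∈S′

  disjoint-subsets-of-size : (j m : ℕ) (X : Subset n) → j * m ≤ ∣ X ∣ →
    ∃ λ Ss → length Ss ≡ m × PairwiseDisjoint Ss × All (λ S → ∣ S ∣ ≡ j) Ss × All (_⊆ X) Ss
  disjoint-subsets-of-size j zero X _ = [] , refl , [] , [] , []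
  disjoint-subsets-of-size j (suc m) X jm+j≤∣X∣
    with split-off X j (≤-trans (m≤m+n j (j * m)) (subst (_≤ ∣ X ∣) (*-suc j m) jm+j≤∣X∣))
  ... | Y , Z , ∣Y∣≡j , ∣Z∣+j≡∣X∣ , Y⊆X , Z⊆X , Y∩Z≡∅
    with disjoint-subsets-of-size j m Z (+-cancelʳ-≤ j (j * m) ∣ Z ∣ jm+j≤∣Z∣+j)
    where
    jm+j≤∣Z∣+j : j * m + j ≤ ∣ Z ∣ + j
    jm+j≤∣Z∣+j = subst₂ _≤_ (trans (*-suc j m) (+-comm j (j * m))) (sym ∣Z∣+j≡∣X∣) jm+j≤∣X∣
  ...   | Ss , length≡m , disjoint , sizes , Ss⊆Z =
    Y ∷ Ss , cong suc length≡m , All.map Y∩S≡∅ Ss⊆Z ∷ disjoint , ∣Y∣≡j ∷ sizes , Y⊆X ∷ All.map S⊆X Ss⊆Z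
    where
    Y∩S≡∅ : ∀ {S} → S ⊆ Z → Disjoint Y S
    Y∩S≡∅ S⊆Z = disjoint⁺ λ x∈Y x∈S → disjoint⁻ Y∩Z≡∅ x∈Y (S⊆Z x∈S)
    S⊆X : ∀ {S} → S ⊆ Z → S ⊆ X
    S⊆X S⊆Z = Z⊆X ∘ S⊆Z

  data Delete (y : A) : List A → List A → Set where
    here  : ∀ {xs} → Delete y (y ∷ xs) xs
    there : ∀ {x xs ys} → Delete y xs ys → Delete y (x ∷ xs) (x ∷ ys)

  Any⇒Delete : ∀ {P : A → Set} {xs} → Any P xs → ∃ λ y → ∃ λ ys → P y × Delete y xs ys
  Any⇒Delete (here py) = _ , _ , py , here
  Any⇒Delete (there any) with Any⇒Delete any
  ... | y , ys , py , del = y , _ , py , there del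

  Delete⇒∈ : ∀ {y : A} {xs ys} → Delete y xs ys → y ∈ₗ xs
  Delete⇒∈ here = here refl
  Delete⇒∈ (there del) = there (Delete⇒∈ del)

  Delete-⊆ : ∀ {y z : A} {xs ys} → Delete y xs ys → z ∈ₗ ys → z ∈ₗ xs
  Delete-⊆ here z∈ys = there z∈ys
  Delete-⊆ (there del) (here refl) = here refl
  Delete-⊆ (there del) (there z∈ys) = there (Delete-⊆ del z∈ys)

  Delete-length : ∀ {y : A} {xs ys} → Delete y xs ys → length xs ≡ suc (length ys)
  Delete-length here = refl
  Delete-length (there del) = cong suc (Delete-length del)

  Delete-All : ∀ {P : A → Set} {y xs ys} → Delete y xs ys → All P xs → P y × All P ys
  Delete-All here (py ∷ pys) = py , pys
  Delete-All (there del) (px ∷ pxs) = let (py , pys) = Delete-All del pxs in py , px ∷ pys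

  Delete-⋃ : ∀ {y} {xs ys : List (Subset n)} → Delete y xs ys → ⋃ ys ⊆ ⋃ xs
  Delete-⋃ {ys = ys} del x∈⋃ys = let (_ , S∈ys , x∈S) = find (∈⋃⁻ ys x∈⋃ys) in ∈⋃⁺ (Delete-⊆ del S∈ys) x∈S

  Delete-PairwiseDisjoint : ∀ {y} {xs ys : List (Subset n)} → Delete y xs ys →
                            PairwiseDisjoint xs → PairwiseDisjoint (y ∷ ys)
  Delete-PairwiseDisjoint here disjoint = disjoint
  Delete-PairwiseDisjoint (there del) (x∩xs≡∅ ∷ disjoint) with Delete-PairwiseDisjoint del disjoint
  ... | y∩ys≡∅ ∷ ys-disjoint =
    (disjoint-sym (All.lookup x∩xs≡∅ (Delete⇒∈ del)) ∷ y∩ys≡∅) ∷ (proj₂ (Delete-All del x∩xs≡∅) ∷ ys-disjoint)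

  sumOver : (A → ℕ) → List A → ℕ
  sumOver f [] = 0
  sumOver f (x ∷ xs) = f x + sumOver f xs

  sumOver-mono-≤ : {f g : A → ℕ} (xs : List A) → All (λ x → f x ≤ g x) xs → sumOver f xs ≤ sumOver g xs
  sumOver-mono-≤ [] [] = z≤n
  sumOver-mono-≤ (x ∷ xs) (fx≤gx ∷ f≤g) = +-mono-≤ fx≤gx (sumOver-mono-≤ xs f≤g)

  sumOver-*ˡ : (c : ℕ) (f : A → ℕ) (xs : List A) → c * sumOver f xs ≡ sumOver (λ x → c * f x) xs
  sumOver-*ˡ c f [] = *-zeroʳ c
  sumOver-*ˡ c f (x ∷ xs) = trans (*-distribˡ-+ c (f x) _) (cong (c * f x +_) (sumOver-*ˡ c f xs))

  length*≤sumOver+length* : (f : A → ℕ) (a c : ℕ) (xs : List A) → All (λ x → a ≤ f x + c) xs →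
                            length xs * a ≤ sumOver f xs + length xs * c
  length*≤sumOver+length* f a c [] [] = z≤n
  length*≤sumOver+length* f a c (x ∷ xs) (a≤fx+c ∷ bounds) = begin
    a + length xs * a                           ≤⟨ +-mono-≤ a≤fx+c (length*≤sumOver+length* f a c xs bounds) ⟩
    f x + c + (sumOver f xs + length xs * c)    ≡⟨ solve 4 (λ fx c s lc → fx :+ c :+ (s :+ lc) := fx :+ s :+ (c :+ lc))
                                                     refl (f x) c (sumOver f xs) (length xs * c) ⟩
    f x + sumOver f xs + (c + length xs * c)    ∎
    where open ≤-Reasoning

  ∣p∩⋃Ss∣≡sumOver : (p : Subset n) {Ss : List (Subset n)} → PairwiseDisjoint Ss →
                    ∣ p ∩ ⋃ Ss ∣ ≡ sumOver (λ S → ∣ p ∩ S ∣) Ss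
  ∣p∩⋃Ss∣≡sumOver {n} p [] = trans (cong ∣_∣ (∩-zeroʳ p)) (∣⊥∣≡0 n)
  ∣p∩⋃Ss∣≡sumOver p {S ∷ Ss} (S∩Ss≡∅ ∷ disjoint) = begin
    ∣ p ∩ (S ∪ ⋃ Ss) ∣                 ≡⟨ cong ∣_∣ (∩-distribˡ-∪ p S (⋃ Ss)) ⟩
    ∣ (p ∩ S) ∪ (p ∩ ⋃ Ss) ∣           ≡⟨ disjoint⇒∣p∪q∣≡∣p∣+∣q∣ (p ∩ S) (p ∩ ⋃ Ss) pieces-disjoint ⟩
    ∣ p ∩ S ∣ + ∣ p ∩ ⋃ Ss ∣           ≡⟨ cong (∣ p ∩ S ∣ +_) (∣p∩⋃Ss∣≡sumOver p disjoint) ⟩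
    sumOver (λ S → ∣ p ∩ S ∣) (S ∷ Ss) ∎
    where
    open ≡-Reasoning
    pieces-disjoint : Disjoint (p ∩ S) (p ∩ ⋃ Ss)
    pieces-disjoint = disjoint⁺ λ x∈p∩S x∈p∩⋃Ss →
      disjoint⁻ (disjoint-⋃ S∩Ss≡∅) (p∩q⊆q p S x∈p∩S) (p∩q⊆q p (⋃ Ss) x∈p∩⋃Ss)

  indicator : Bool → ℕ
  indicator true = 1
  indicator false = 0

  indicator≤1 : ∀ b → indicator b ≤ 1
  indicator≤1 true = ≤-refl
  indicator≤1 false = z≤n

  count : (A → Bool) → List A → ℕ
  count g = sumOver (indicator ∘ g)

  count≤length : (g : A → Bool) (xs : List A) → count g xs ≤ length xs
  count≤length g [] = z≤n
  count≤length g (x ∷ xs) with g x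
  ... | true = s≤s (count≤length g xs)
  ... | false = m≤n⇒m≤1+n (count≤length g xs)

  count-++ : (g : A → Bool) (xs ys : List A) → count g (xs ++ ys) ≡ count g xs + count g ys
  count-++ g [] ys = refl
  count-++ g (x ∷ xs) ys = trans (cong (indicator (g x) +_) (count-++ g xs ys)) (sym (+-assoc (indicator (g x)) _ _))

  count-map : (g : A → Bool) (f : C → A) (xs : List C) → count g (map f xs) ≡ count (g ∘ f) xs
  count-map g f [] = refl
  count-map g f (x ∷ xs) = cong (indicator (g (f x)) +_) (count-map g f xs)

  count-none : (g : A → Bool) (xs : List A) → (∀ x → g x ≢ true) → count g xs ≡ 0
  count-none g [] _ = refl
  count-none g (x ∷ xs) never with g x in gx≡b
  ... | true = ⊥-elim (never x gx≡b)
  ... | false = count-none g xs never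

  count-Delete : (g : A → Bool) {y : A} {xs ys : List A} → Delete y xs ys → count g xs ≡ indicator (g y) + count g ys
  count-Delete g here = refl
  count-Delete g {y} (there {x} {xs} {ys} del) = begin
    indicator (g x) + count g xs                      ≡⟨ cong (indicator (g x) +_) (count-Delete g del) ⟩
    indicator (g x) + (indicator (g y) + count g ys)  ≡⟨ solve 3 (λ a b c → a :+ (b :+ c) := b :+ (a :+ c)) refl
                                                           (indicator (g x)) (indicator (g y)) (count g ys) ⟩
    indicator (g y) + (indicator (g x) + count g ys)  ∎
    where open ≡-Reasoning

  1≤count⇒Delete : (g : A → Bool) (xs : List A) → 1 ≤ count g xs → ∃ λ y → ∃ λ ys → g y ≡ true × Delete y xs ys
  1≤count⇒Delete g (x ∷ xs) 1≤count with g x in gx≡b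
  ... | true = x , xs , gx≡b , here
  ... | false with 1≤count⇒Delete g xs 1≤count
  ...   | y , ys , gy , del = y , x ∷ ys , gy , there del

  count-filter-¬ : (g : A → Bool) {P : A → Set} (P? : ∀ x → Dec (P x)) (xs : List A) →
                   count g xs ≤ count g (filter (¬? ∘ P?) xs) + count (does ∘ P?) xs
  count-filter-¬ g P? [] = z≤n
  count-filter-¬ g P? (x ∷ xs) with P? x
  ... | no _ = begin
    indicator (g x) + count g xs                    ≤⟨ +-monoʳ-≤ (indicator (g x)) (count-filter-¬ g P? xs) ⟩
    indicator (g x) + (accepted + rejected)         ≡⟨ sym (+-assoc (indicator (g x)) accepted rejected) ⟩
    indicator (g x) + accepted + rejected           ∎
    where
    open ≤-Reasoning
    accepted = count g (filter (¬? ∘ P?) xs)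
    rejected = count (does ∘ P?) xs
  ... | yes _ = begin
    indicator (g x) + count g xs                    ≤⟨ +-monoʳ-≤ (indicator (g x)) (count-filter-¬ g P? xs) ⟩
    indicator (g x) + (accepted + rejected)         ≤⟨ +-monoˡ-≤ _ (indicator≤1 (g x)) ⟩
    1 + (accepted + rejected)                       ≡⟨ solve 2 (λ a r → con 1 :+ (a :+ r) := a :+ (con 1 :+ r)) refl accepted rejected ⟩
    accepted + (1 + rejected)                       ∎
    where
    open ≤-Reasoning
    accepted = count g (filter (¬? ∘ P?) xs)
    rejected = count (does ∘ P?) xs

  length-filter-filter : {P Q : A → Set} (P? : ∀ x → Dec (P x)) (Q? : ∀ x → Dec (Q x)) (xs : List A) →
                         length (filter P? (filter Q? xs)) ≡ count (λ x → does (Q? x) Bool.∧ does (P? x)) xs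
  length-filter-filter P? Q? [] = refl
  length-filter-filter P? Q? (x ∷ xs) with does (Q? x)
  ... | false = length-filter-filter P? Q? xs
  ... | true with does (P? x)
  ...   | true = cong suc (length-filter-filter P? Q? xs)
  ...   | false = length-filter-filter P? Q? xs

  count-meeting≤∣p∩⋃Ss∣ : (p : Subset n) {Ss : List (Subset n)} → PairwiseDisjoint Ss →
                          count (λ S → does (nonempty? (S ∩ p))) Ss ≤ ∣ p ∩ ⋃ Ss ∣
  count-meeting≤∣p∩⋃Ss∣ p {Ss} disjoint = begin
    count (λ S → does (nonempty? (S ∩ p))) Ss ≤⟨ sumOver-mono-≤ Ss (All.tabulate λ {S} _ → meets⇒1≤ S) ⟩
    sumOver (λ S → ∣ p ∩ S ∣) Ss               ≡⟨ sym (∣p∩⋃Ss∣≡sumOver p disjoint) ⟩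
    ∣ p ∩ ⋃ Ss ∣                               ∎
    where
    open ≤-Reasoning
    meets⇒1≤ : ∀ S → indicator (does (nonempty? (S ∩ p))) ≤ ∣ p ∩ S ∣
    meets⇒1≤ S with nonempty? (S ∩ p)
    ... | yes (x , x∈S∩p) = Nonempty⇒1≤∣p∣ (x , x∈p∩q⁺ (p∩q⊆q S p x∈S∩p , p∩q⊆p S p x∈S∩p))
    ... | no _ = z≤n

  sumFin : (Fin n → ℕ) → ℕ
  sumFin {zero} f = 0
  sumFin {suc n} f = f zero + sumFin (f ∘ suc)

  sumFin-mono-≤ : {f g : Fin n → ℕ} → (∀ v → f v ≤ g v) → sumFin f ≤ sumFin g
  sumFin-mono-≤ {zero} f≤g = z≤n
  sumFin-mono-≤ {suc n} f≤g = +-mono-≤ (f≤g zero) (sumFin-mono-≤ (f≤g ∘ suc))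

  sumFin-+ : (f g : Fin n → ℕ) → sumFin (λ v → f v + g v) ≡ sumFin f + sumFin g
  sumFin-+ {zero} f g = refl
  sumFin-+ {suc n} f g = trans (cong (f zero + g zero +_) (sumFin-+ (f ∘ suc) (g ∘ suc)))
    (solve 4 (λ a b c d → a :+ b :+ (c :+ d) := a :+ c :+ (b :+ d)) refl (f zero) (g zero) (sumFin (f ∘ suc)) (sumFin (g ∘ suc)))

  sumFin-*ʳ : (c : ℕ) (f : Fin n → ℕ) → sumFin (λ v → f v * c) ≡ sumFin f * c
  sumFin-*ʳ {zero} c f = refl
  sumFin-*ʳ {suc n} c f = trans (cong (f zero * c +_) (sumFin-*ʳ c (f ∘ suc))) (sym (*-distribʳ-+ c (f zero) _))

  sumFin-const : (n c : ℕ) → sumFin {n} (λ _ → c) ≡ n * c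
  sumFin-const zero c = refl
  sumFin-const (suc n) c = cong (c +_) (sumFin-const n c)

  sumOver-sumFin-comm : (g : A → Fin n → ℕ) (xs : List A) →
                        sumOver (λ x → sumFin (g x)) xs ≡ sumFin (λ v → sumOver (λ x → g x v) xs)
  sumOver-sumFin-comm {n = n} g [] = sym (trans (sumFin-const n 0) (*-zeroʳ n))
  sumOver-sumFin-comm g (x ∷ xs) = trans (cong (sumFin (g x) +_) (sumOver-sumFin-comm g xs)) (sym (sumFin-+ (g x) _))

  ∣tabulate∣≡sumFin : (f : Fin n → Bool) → ∣ tabulate f ∣ ≡ sumFin (indicator ∘ f)
  ∣tabulate∣≡sumFin {zero} f = refl
  ∣tabulate∣≡sumFin {suc n} f with f zero
  ... | true = cong suc (∣tabulate∣≡sumFin (f ∘ suc))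
  ... | false = ∣tabulate∣≡sumFin (f ∘ suc)

  ∈tabulate⇔ : {f : Fin n → Bool} → x ∈ tabulate f ⇔ f x ≡ true
  ∈tabulate⇔ {x = x} {f = f} = mk⇔ (λ x∈ → trans (sym (lookup∘tabulate f x)) ([]=⇒lookup x∈))
                              (λ fx → lookup⇒[]= x (tabulate f) (trans (lookup∘tabulate f x) fx))

  count-allSubsets-suc : (P : Subset (suc n) → Bool) →
    count P (allSubsets (suc n)) ≡ count (P ∘ (inside ∷_)) (allSubsets n) + count (P ∘ (outside ∷_)) (allSubsets n)
  count-allSubsets-suc {n} P =
    trans (count-++ P (map (inside ∷_) (allSubsets n)) (map (outside ∷_) (allSubsets n)))
          (cong₂ _+_ (count-map P (inside ∷_) (allSubsets n)) (count-map P (outside ∷_) (allSubsets n)))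

  count-allSubsets-≤-indicator : (P : Subset n → Bool) (S : Subset n) →
    (∀ e → P e ≡ true → S ⊆ e × ∣ e ∣ ≡ ∣ S ∣) → count P (allSubsets n) ≤ indicator (P S)
  count-allSubsets-≤-indicator {zero} P [] _ = ≤-reflexive (+-identityʳ _)
  count-allSubsets-≤-indicator {suc n} P (true ∷ S) onlyS = begin
    count P (allSubsets (suc n))                                          ≡⟨ count-allSubsets-suc P ⟩
    count (P ∘ (inside ∷_)) (allSubsets n) + count (P ∘ (outside ∷_)) (allSubsets n)
      ≡⟨ cong (count (P ∘ (inside ∷_)) (allSubsets n) +_) (count-none _ (allSubsets n) λ e Pe → zero∉ (proj₁ (onlyS _ Pe) here)) ⟩
    count (P ∘ (inside ∷_)) (allSubsets n) + 0                            ≡⟨ +-identityʳ _ ⟩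
    count (P ∘ (inside ∷_)) (allSubsets n)
      ≤⟨ count-allSubsets-≤-indicator (P ∘ (inside ∷_)) S
           (λ e Pe → drop-∷-⊆ (proj₁ (onlyS _ Pe)) , suc-injective (proj₂ (onlyS _ Pe))) ⟩
    indicator (P (true ∷ S))                                              ∎
    where
    open ≤-Reasoning
    zero∉ : ∀ {e : Subset n} → zero ∉ outside ∷ e
    zero∉ ()
  count-allSubsets-≤-indicator {suc n} P (false ∷ S) onlyS = begin
    count P (allSubsets (suc n))                                          ≡⟨ count-allSubsets-suc P ⟩
    count (P ∘ (inside ∷_)) (allSubsets n) + count (P ∘ (outside ∷_)) (allSubsets n)
      ≡⟨ cong (_+ count (P ∘ (outside ∷_)) (allSubsets n)) (count-none _ (allSubsets n) λ e Pe → too-big (onlyS _ Pe)) ⟩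
    count (P ∘ (outside ∷_)) (allSubsets n)
      ≤⟨ count-allSubsets-≤-indicator (P ∘ (outside ∷_)) S
           (λ e Pe → drop-∷-⊆ (proj₁ (onlyS _ Pe)) , proj₂ (onlyS _ Pe)) ⟩
    indicator (P (false ∷ S))                                             ∎
    where
    open ≤-Reasoning
    too-big : ∀ {e} → ¬ (false ∷ S ⊆ true ∷ e × suc ∣ e ∣ ≡ ∣ S ∣)
    too-big (S⊆e , 1+∣e∣≡∣S∣) = <⇒≱ (≤-reflexive 1+∣e∣≡∣S∣) (p⊆q⇒∣p∣≤∣q∣ (drop-∷-⊆ S⊆e))

  count-allSubsets-≤-extensions : (P : Subset n → Bool) (S : Subset n) →
    (∀ e → P e ≡ true → S ⊆ e × ∣ e ∣ ≡ suc ∣ S ∣) → count P (allSubsets n) ≤ sumFin (λ v → indicator (P (S ∪ ⁅ v ⁆)))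
  count-allSubsets-≤-extensions {zero} P [] grows with P [] in P[]
  ... | true = ⊥-elim (0≢1+n (proj₂ (grows [] P[])))
  ... | false = z≤n
  count-allSubsets-≤-extensions {suc n} P (true ∷ S) grows = begin
    count P (allSubsets (suc n))                                          ≡⟨ count-allSubsets-suc P ⟩
    count (P ∘ (inside ∷_)) (allSubsets n) + count (P ∘ (outside ∷_)) (allSubsets n)
      ≡⟨ cong (count (P ∘ (inside ∷_)) (allSubsets n) +_) (count-none _ (allSubsets n) λ e Pe → zero∉ (proj₁ (grows _ Pe) here)) ⟩
    count (P ∘ (inside ∷_)) (allSubsets n) + 0                            ≡⟨ +-identityʳ _ ⟩
    count (P ∘ (inside ∷_)) (allSubsets n)
      ≤⟨ count-allSubsets-≤-extensions (P ∘ (inside ∷_)) S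
           (λ e Pe → drop-∷-⊆ (proj₁ (grows _ Pe)) , suc-injective (proj₂ (grows _ Pe))) ⟩
    sumFin (λ v → indicator (P (true ∷ S ∪ ⁅ v ⁆)))                       ≤⟨ m≤n+m _ _ ⟩
    sumFin (λ v → indicator (P ((true ∷ S) ∪ ⁅ v ⁆)))                     ∎
    where
    open ≤-Reasoning
    zero∉ : ∀ {e : Subset n} → zero ∉ outside ∷ e
    zero∉ ()
  count-allSubsets-≤-extensions {suc n} P (false ∷ S) grows = begin
    count P (allSubsets (suc n))                                          ≡⟨ count-allSubsets-suc P ⟩
    count (P ∘ (inside ∷_)) (allSubsets n) + count (P ∘ (outside ∷_)) (allSubsets n)
      ≤⟨ +-mono-≤ (count-allSubsets-≤-indicator (P ∘ (inside ∷_)) S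
                     (λ e Pe → drop-∷-⊆ (proj₁ (grows _ Pe)) , suc-injective (proj₂ (grows _ Pe))))
                  (count-allSubsets-≤-extensions (P ∘ (outside ∷_)) S
                     (λ e Pe → drop-∷-⊆ (proj₁ (grows _ Pe)) , proj₂ (grows _ Pe))) ⟩
    indicator (P (true ∷ S)) + sumFin (λ v → indicator (P (false ∷ S ∪ ⁅ v ⁆)))
      ≡⟨ cong (λ S′ → indicator (P (true ∷ S′)) + sumFin (λ v → indicator (P (false ∷ S ∪ ⁅ v ⁆)))) (sym (∪-identityʳ S)) ⟩
    sumFin (λ v → indicator (P ((false ∷ S) ∪ ⁅ v ⁆)))                    ∎
    where open ≤-Reasoning

  module _ {k n : ℕ} (H : Hypergraph k n) where

    extends : Subset n → Fin n → Bool
    extends S v = isEdge H (S ∪ ⁅ v ⁆)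

    deg≤sumFin-extends : (S : Subset n) → suc ∣ S ∣ ≡ k → deg H S ≤ sumFin (λ v → indicator (extends S v))
    deg≤sumFin-extends S ∣S∣+1≡k = begin
      deg H S                                                ≡⟨ length-filter-filter (S ⊆?_) isEdge? (allSubsets n) ⟩
      count P (allSubsets n)                                 ≤⟨ count-allSubsets-≤-extensions P S edges⊇S ⟩
      sumFin (λ v → indicator (P (S ∪ ⁅ v ⁆)))               ≤⟨ sumFin-mono-≤ (λ v → indicator-∧ (isEdge H (S ∪ ⁅ v ⁆)) _) ⟩
      sumFin (λ v → indicator (extends S v))                 ∎
      where
      open ≤-Reasoning
      isEdge? : ∀ e → Dec (isEdge H e ≡ true)
      isEdge? e = isEdge H e Bool.≟ true
      P : Subset n → Bool
      P e = does (isEdge? e) Bool.∧ does (S ⊆? e)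
      edges⊇S : ∀ e → P e ≡ true → S ⊆ e × ∣ e ∣ ≡ suc ∣ S ∣
      edges⊇S e Pe with isEdge? e | S ⊆? e
      edges⊇S e Pe | yes e∈H | yes S⊆e = S⊆e , trans (uniform H e e∈H) (sym ∣S∣+1≡k)
      edges⊇S e () | yes _ | no _
      edges⊇S e () | no _ | _
      indicator-∧ : ∀ a b → indicator (does (a Bool.≟ true) Bool.∧ b) ≤ indicator a
      indicator-∧ true true = ≤-refl
      indicator-∧ true false = z≤n
      indicator-∧ false b = z≤n

  -- Augmenting a matching

  module _ {k n : ℕ} (H : Hypergraph k n) where

    Larger : List (Subset n) → Set
    Larger M = ∃ λ M′ → IsMatching H M′ × length M′ ≡ suc (length M)

    -- R supplies the sets for trading an edge e of M that meets f for S ∪ {v} (S ∈ R, v ∈ e ∖ f).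
    -- A trade lowers |f ∩ ⋃ M| by at least one and each count by at most one, so trading can go on
    -- until f avoids M.
    record Reserve (M : List (Subset n)) (f : Subset n) (R : List (Subset n)) : Set where
      field
        disjoint    : PairwiseDisjoint R
        avoids-f    : All (λ S → Disjoint S f) R
        avoids-M    : All (λ S → Disjoint S (⋃ M)) R
        replaceable : ∀ {e} → e ∈ₗ M → Nonempty (e ∩ f) →
                      ∃ λ v → v ∈ e × v ∉ f × ∣ f ∩ ⋃ M ∣ ≤ count (λ S → extends H S v) R

    module Swap {M rest : List (Subset n)} {e} (M-matching : IsMatching H M) (e-del : Delete e M rest)
                {f R R′ S} (R-reserve : Reserve M f R) (S-del : Delete S R R′)
                {v} (v∈e : v ∈ e) (v∉f : v ∉ f) (S+v-edge : extends H S v ≡ true) where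

      open Reserve R-reserve

      M′ : List (Subset n)
      M′ = S ∪ ⁅ v ⁆ ∷ rest

      e-avoids-rest : All (Disjoint e) rest
      e-avoids-rest = AllPairs.head (Delete-PairwiseDisjoint e-del (proj₂ M-matching))

      S-avoids-f : Disjoint S f
      S-avoids-f = proj₁ (Delete-All S-del avoids-f)

      S-avoids-M : Disjoint S (⋃ M)
      S-avoids-M = proj₁ (Delete-All S-del avoids-M)

      v∈⋃M : v ∈ ⋃ M
      v∈⋃M = ∈⋃⁺ (Delete⇒∈ e-del) v∈e

      S+v-avoids-f : Disjoint (S ∪ ⁅ v ⁆) f
      S+v-avoids-f = disjoint⁺ λ {y} y∈S+v y∈f → case ∈p∪⁅y⁆⁻ S v y∈S+v of λ where
        (inj₁ y∈S) → disjoint⁻ S-avoids-f y∈S y∈f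
        (inj₂ refl) → v∉f y∈f

      matching : IsMatching H M′
      matching = (S+v-edge ∷ proj₂ (Delete-All e-del (proj₁ M-matching))) ,
                 All.tabulate (λ e′∈rest → disjoint⁺ (S+v-avoids e′∈rest))
                   ∷ AllPairs.tail (Delete-PairwiseDisjoint e-del (proj₂ M-matching))
        where
        S+v-avoids : ∀ {e′ y} → e′ ∈ₗ rest → y ∈ S ∪ ⁅ v ⁆ → y ∉ e′
        S+v-avoids e′∈rest y∈S+v y∈e′ with ∈p∪⁅y⁆⁻ S v y∈S+v
        ... | inj₁ y∈S = disjoint⁻ S-avoids-M y∈S (∈⋃⁺ (Delete-⊆ e-del e′∈rest) y∈e′)
        ... | inj₂ refl = disjoint⁻ (All.lookup e-avoids-rest e′∈rest) v∈e y∈e′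

      f∩⋃M′⊆f∩⋃M : f ∩ ⋃ M′ ⊆ f ∩ ⋃ M
      f∩⋃M′⊆f∩⋃M y∈f∩M′ with p∩q⊆p f (⋃ M′) y∈f∩M′ | x∈p∪q⁻ (S ∪ ⁅ v ⁆) (⋃ rest) (p∩q⊆q f (⋃ M′) y∈f∩M′)
      ... | y∈f | inj₁ y∈S+v = ⊥-elim (disjoint⁻ S+v-avoids-f y∈S+v y∈f)
      ... | y∈f | inj₂ y∈rest = x∈p∩q⁺ (y∈f , Delete-⋃ e-del y∈rest)

      shrinks : ∀ {x} → x ∈ e → x ∈ f → ∣ f ∩ ⋃ M′ ∣ < ∣ f ∩ ⋃ M ∣
      shrinks {x} x∈e x∈f = p⊂q⇒∣p∣<∣q∣ (f∩⋃M′⊆f∩⋃M , x , x∈p∩q⁺ (x∈f , ∈⋃⁺ (Delete⇒∈ e-del) x∈e) , x∉f∩⋃M′)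
        where
        x∉f∩⋃M′ : x ∉ f ∩ ⋃ M′
        x∉f∩⋃M′ x∈f∩M′ with x∈p∪q⁻ (S ∪ ⁅ v ⁆) (⋃ rest) (p∩q⊆q f (⋃ M′) x∈f∩M′)
        ... | inj₁ x∈S+v = disjoint⁻ S+v-avoids-f x∈S+v x∈f
        ... | inj₂ x∈rest = disjoint⁻ (disjoint-⋃ e-avoids-rest) x∈e x∈rest

      reserve : ∣ f ∩ ⋃ M′ ∣ < ∣ f ∩ ⋃ M ∣ → Reserve M′ f R′
      reserve M′-smaller = record
        { disjoint    = AllPairs.tail (Delete-PairwiseDisjoint S-del disjoint)
        ; avoids-f    = proj₂ (Delete-All S-del avoids-f)
        ; avoids-M    = All.tabulate λ S′∈R′ → disjoint⁺ (S′-avoids-M′ S′∈R′)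
        ; replaceable = replaceable′
        }
        where
        S′-avoids-M′ : ∀ {S′ y} → S′ ∈ₗ R′ → y ∈ S′ → y ∉ ⋃ M′
        S′-avoids-M′ {S′} S′∈R′ y∈S′ y∈M′ with x∈p∪q⁻ (S ∪ ⁅ v ⁆) (⋃ rest) y∈M′
        ... | inj₂ y∈rest = disjoint⁻ (All.lookup avoids-M (Delete-⊆ S-del S′∈R′)) y∈S′ (Delete-⋃ e-del y∈rest)
        ... | inj₁ y∈S+v with ∈p∪⁅y⁆⁻ S v y∈S+v
        ...   | inj₁ y∈S = disjoint⁻ (All.lookup (AllPairs.head (Delete-PairwiseDisjoint S-del disjoint)) S′∈R′) y∈S y∈S′
        ...   | inj₂ refl = disjoint⁻ (All.lookup avoids-M (Delete-⊆ S-del S′∈R′)) y∈S′ v∈⋃M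
        replaceable′ : ∀ {e′} → e′ ∈ₗ M′ → Nonempty (e′ ∩ f) →
                       ∃ λ v′ → v′ ∈ e′ × v′ ∉ f × ∣ f ∩ ⋃ M′ ∣ ≤ count (λ S′ → extends H S′ v′) R′
        replaceable′ (here refl) (y , y∈e′∩f) = ⊥-elim (S+v-avoids-f (y , y∈e′∩f))
        replaceable′ (there e′∈rest) e′-meets-f with replaceable (Delete-⊆ e-del e′∈rest) e′-meets-f
        ... | v′ , v′∈e′ , v′∉f , M-bound = v′ , v′∈e′ , v′∉f , +-cancelˡ-≤ 1 _ _ (begin
          suc ∣ f ∩ ⋃ M′ ∣                                     ≤⟨ M′-smaller ⟩
          ∣ f ∩ ⋃ M ∣                                          ≤⟨ M-bound ⟩
          count (λ S′ → extends H S′ v′) R                       ≡⟨ count-Delete (λ S′ → extends H S′ v′) S-del ⟩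
          indicator (extends H S v′) + count (λ S′ → extends H S′ v′) R′ ≤⟨ +-monoˡ-≤ _ (indicator≤1 (extends H S v′)) ⟩
          1 + count (λ S′ → extends H S′ v′) R′                  ∎)
          where open ≤-Reasoning

    augment : (fuel : ℕ) {M : List (Subset n)} → IsMatching H M → {f : Subset n} → isEdge H f ≡ true →
              ∣ f ∩ ⋃ M ∣ ≤ fuel → ∀ {R} → Reserve M f R → Larger M
    augment fuel {M} M-matching {f} f-edge f∩M≤fuel {R} R-reserve with nonempty? (f ∩ ⋃ M)
    ... | no f-avoids-M = f ∷ M , (f-edge ∷ proj₁ M-matching , disjoint-⋃⁻ f-avoids-M ∷ proj₂ M-matching) , refl
    ... | yes (x , x∈f∩M) with Any⇒Delete (∈⋃⁻ M (p∩q⊆q f (⋃ M) x∈f∩M))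
    ...   | e , rest , x∈e , e-del with Reserve.replaceable R-reserve (Delete⇒∈ e-del) (x , x∈p∩q⁺ (x∈e , p∩q⊆p f (⋃ M) x∈f∩M))
    ...     | v , v∈e , v∉f , f∩M≤count
      with 1≤count⇒Delete (λ S → extends H S v) R (≤-trans (Nonempty⇒1≤∣p∣ (x , x∈f∩M)) f∩M≤count)
    ...       | S , R′ , S+v-edge , S-del = recurse fuel f∩M≤fuel
      where
      x∈f = p∩q⊆p f (⋃ M) x∈f∩M
      open Swap M-matching e-del R-reserve S-del v∈e v∉f S+v-edge
      recurse : (fuel : ℕ) → ∣ f ∩ ⋃ M ∣ ≤ fuel → Larger M
      recurse zero f∩M≤0 = ⊥-elim (<⇒≱ (≤-trans (s≤s z≤n) (shrinks x∈e x∈f)) f∩M≤0)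
      recurse (suc fuel) f∩M≤1+fuel with augment fuel matching f-edge
                                           (≤-pred (≤-trans (shrinks x∈e x∈f) f∩M≤1+fuel)) (reserve (shrinks x∈e x∈f))
      ... | M″ , M″-matching , length-M″ = M″ , M″-matching , trans length-M″ (cong suc (sym (Delete-length e-del)))

  -- Heavy vertices

  module Heavy {k₁ n : ℕ} (H : Hypergraph (suc k₁) n) {M : List (Subset n)} (M-matching : IsMatching H M)
               {Ss : List (Subset n)} (Ss-disjoint : PairwiseDisjoint Ss) (Ss-uncovered : All (_⊆ ∁ (⋃ M)) Ss) where

    U : Subset n
    U = ∁ (⋃ M)

    load : Fin n → ℕ
    load v = count (λ S → extends H S v) Ss

    isHeavy : Fin n → Bool
    isHeavy v = suc k₁ ≤ᵇ load v

    heavy : Subset n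
    heavy = tabulate isHeavy

    heavy⇒k≤load : ∀ {v} → v ∈ heavy → suc k₁ ≤ load v
    heavy⇒k≤load {v} v∈heavy = ≤ᵇ⇒≤ (suc k₁) (load v) (Equivalence.from T-≡ (Equivalence.to ∈tabulate⇔ v∈heavy))

    touched : Subset n
    touched = ⋃ (filter (λ e → nonempty? (e ∩ heavy)) M)

    I : Subset n
    I = U ∪ (touched ∩ ∁ heavy)

    -- At most |f ∩ U| sets of Ss meet f, so a heavy v keeps k − |f ∩ U| = |f ∩ ⋃ M| of them.
    augment-via-heavy : ∀ {f} → isEdge H f ≡ true →
                        (∀ {e} → e ∈ₗ M → Nonempty (e ∩ f) → ∃ λ v → v ∈ e × v ∉ f × v ∈ heavy) → Larger H M
    augment-via-heavy {f} f-edge heavy-outside-f = augment H ∣ f ∩ ⋃ M ∣ M-matching f-edge ≤-refl reserve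
      where
      avoids-f? : ∀ S → Dec (Disjoint S f)
      avoids-f? S = ¬? (nonempty? (S ∩ f))
      reserved : List (Subset n)
      reserved = filter avoids-f? Ss
      ∣f∩⋃M∣+∣f∩U∣≡k : ∣ f ∩ ⋃ M ∣ + ∣ f ∩ U ∣ ≡ suc k₁
      ∣f∩⋃M∣+∣f∩U∣≡k = trans (∣p∩q∣+∣p∩∁q∣≡∣p∣ f (⋃ M)) (uniform H f f-edge)
      meeting≤∣f∩U∣ : count (λ S → does (nonempty? (S ∩ f))) Ss ≤ ∣ f ∩ U ∣
      meeting≤∣f∩U∣ = ≤-trans (count-meeting≤∣p∩⋃Ss∣ f Ss-disjoint) (p⊆q⇒∣p∣≤∣q∣ λ y∈f∩Ss →
        let (_ , S∈Ss , y∈S) = find (∈⋃⁻ Ss (p∩q⊆q f (⋃ Ss) y∈f∩Ss))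
        in x∈p∩q⁺ (p∩q⊆p f (⋃ Ss) y∈f∩Ss , All.lookup Ss-uncovered S∈Ss y∈S))
      reserve : Reserve H M f reserved
      reserve = record
        { disjoint    = AllPairs.filter⁺ avoids-f? Ss-disjoint
        ; avoids-f    = All.tabulate (proj₂ ∘ ∈-filter⁻ avoids-f? {xs = Ss})
        ; avoids-M    = All.tabulate λ S∈T → disjoint⁺ λ y∈S →
                          x∈∁p⇒x∉p (All.lookup Ss-uncovered (proj₁ (∈-filter⁻ avoids-f? {xs = Ss} S∈T)) y∈S)
        ; replaceable = λ e∈M e-meets-f → let (v , v∈e , v∉f , v-heavy) = heavy-outside-f e∈M e-meets-f in
                          v , v∈e , v∉f , +-cancelʳ-≤ _ _ _ (begin
                            ∣ f ∩ ⋃ M ∣ + ∣ f ∩ U ∣       ≡⟨ ∣f∩⋃M∣+∣f∩U∣≡k ⟩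
                            suc k₁                              ≤⟨ heavy⇒k≤load v-heavy ⟩
                            load v                              ≤⟨ count-filter-¬ (λ S → extends H S v) (λ S → nonempty? (S ∩ f)) Ss ⟩
                            count (λ S → extends H S v) reserved + count (λ S → does (nonempty? (S ∩ f))) Ss
                                                                ≤⟨ +-monoʳ-≤ _ meeting≤∣f∩U∣ ⟩
                            count (λ S → extends H S v) reserved + ∣ f ∩ U ∣ ∎)
        }
        where open ≤-Reasoning

    edge-in-I⇒Larger : ∀ {f} → isEdge H f ≡ true → f ⊆ I → Larger H M
    edge-in-I⇒Larger {f} f-edge f⊆I = augment-via-heavy f-edge heavy-outside-f
      where
      heavy-outside-f : ∀ {e} → e ∈ₗ M → Nonempty (e ∩ f) → ∃ λ v → v ∈ e × v ∉ f × v ∈ heavy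
      heavy-outside-f {e} e∈M (y , y∈e∩f) with x∈p∪q⁻ U (touched ∩ ∁ heavy) (f⊆I (p∩q⊆q e f y∈e∩f))
      ... | inj₁ y∈U = ⊥-elim (x∈∁p⇒x∉p y∈U (∈⋃⁺ e∈M (p∩q⊆p e f y∈e∩f)))
      ... | inj₂ y∈touched-light =
        let (e′ , e′∈touching , y∈e′) = find (∈⋃⁻ _ (p∩q⊆p touched (∁ heavy) y∈touched-light))
            (e′∈M , (v , v∈e′∩heavy)) = ∈-filter⁻ (λ e → nonempty? (e ∩ heavy)) {xs = M} e′∈touching
            e′≡e = disjoint-members-equal (proj₂ M-matching) e′∈M e∈M y∈e′ (p∩q⊆p e f y∈e∩f)
            v∈e′ = p∩q⊆p e′ heavy v∈e′∩heavy
            v∈heavy = p∩q⊆q e′ heavy v∈e′∩heavy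
            v∉f : v ∉ f
            v∉f v∈f = case x∈p∪q⁻ U (touched ∩ ∁ heavy) (f⊆I v∈f) of λ where
              (inj₁ v∈U) → x∈∁p⇒x∉p v∈U (∈⋃⁺ e′∈M v∈e′)
              (inj₂ v∈light) → x∈∁p⇒x∉p (p∩q⊆q touched (∁ heavy) v∈light) v∈heavy
        in v , subst (v ∈_) e′≡e v∈e′ , v∉f , v∈heavy

    two-heavy⇒Larger : ∀ {e} → e ∈ₗ M → 2 ≤ ∣ e ∩ heavy ∣ → Larger H M
    two-heavy⇒Larger {e} e∈M 2≤∣e∩heavy∣ with 2≤∣p∣⇒distinct-members (e ∩ heavy) 2≤∣e∩heavy∣
    ... | v , w , v∈e∩heavy , w∈e∩heavy , v≢w
      with 1≤count⇒Delete (λ S → extends H S w) Ss (≤-trans (s≤s z≤n) (heavy⇒k≤load (p∩q⊆q e heavy w∈e∩heavy)))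
    ... | S , _ , S+w-edge , S-del = augment-via-heavy S+w-edge heavy-outside-f
      where
      S-uncovered : S ⊆ U
      S-uncovered = All.lookup Ss-uncovered (Delete⇒∈ S-del)
      v∈e = p∩q⊆p e heavy v∈e∩heavy
      heavy-outside-f : ∀ {e′} → e′ ∈ₗ M → Nonempty (e′ ∩ (S ∪ ⁅ w ⁆)) → ∃ λ v → v ∈ e′ × v ∉ S ∪ ⁅ w ⁆ × v ∈ heavy
      heavy-outside-f {e′} e′∈M (y , y∈e′∩S+w) with ∈p∪⁅y⁆⁻ S w (p∩q⊆q e′ (S ∪ ⁅ w ⁆) y∈e′∩S+w)
      ... | inj₁ y∈S = ⊥-elim (x∈∁p⇒x∉p (S-uncovered y∈S) (∈⋃⁺ e′∈M (p∩q⊆p e′ (S ∪ ⁅ w ⁆) y∈e′∩S+w)))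
      ... | inj₂ refl = v , subst (v ∈_) e≡e′ v∈e , v∉S+w , p∩q⊆q e heavy v∈e∩heavy
        where
        e≡e′ = disjoint-members-equal (proj₂ M-matching) e∈M e′∈M (p∩q⊆p e heavy w∈e∩heavy) (p∩q⊆p e′ (S ∪ ⁅ w ⁆) y∈e′∩S+w)
        v∉S+w : v ∉ S ∪ ⁅ w ⁆
        v∉S+w v∈S+w with ∈p∪⁅y⁆⁻ S w v∈S+w
        ... | inj₁ v∈S = x∈∁p⇒x∉p (S-uncovered v∈S) (∈⋃⁺ e∈M v∈e)
        ... | inj₂ v≡w = v≢w v≡w

    heavy⊆⋃M : (∀ {f} → isEdge H f ≡ true → ¬ f ⊆ I) → heavy ⊆ ⋃ M
    heavy⊆⋃M no-edge-in-I {v} v∈heavy with v ∈? ⋃ M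
    ... | yes v∈M = v∈M
    ... | no v∉M with 1≤count⇒Delete (λ S → extends H S v) Ss (≤-trans (s≤s z≤n) (heavy⇒k≤load v∈heavy))
    ...   | S , _ , S+v-edge , S-del = ⊥-elim (no-edge-in-I S+v-edge S+v⊆I)
      where
      S+v⊆I : S ∪ ⁅ v ⁆ ⊆ I
      S+v⊆I y∈S+v = p⊆p∪q (touched ∩ ∁ heavy) (case ∈p∪⁅y⁆⁻ S v y∈S+v of λ where
        (inj₁ y∈S) → All.lookup Ss-uncovered (Delete⇒∈ S-del) y∈S
        (inj₂ refl) → x∉p⇒x∈∁p v∉M)

    k₁*∣heavy∣≤∣I∣ : (∀ {f} → isEdge H f ≡ true → ¬ f ⊆ I) → (∀ {e} → e ∈ₗ M → ∣ e ∩ heavy ∣ ≤ 1) →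
                     k₁ * ∣ heavy ∣ ≤ ∣ I ∣
    k₁*∣heavy∣≤∣I∣ no-edge-in-I at-most-one = begin
      k₁ * ∣ heavy ∣                        ≤⟨ *-monoʳ-≤ k₁ (p⊆q⇒∣p∣≤∣q∣ λ v∈heavy → x∈p∩q⁺ (v∈heavy , heavy⊆⋃M no-edge-in-I v∈heavy)) ⟩
      k₁ * ∣ heavy ∩ ⋃ M ∣                  ≡⟨ cong (k₁ *_) (∣p∩⋃Ss∣≡sumOver heavy (proj₂ M-matching)) ⟩
      k₁ * sumOver (λ e → ∣ heavy ∩ e ∣) M  ≡⟨ sumOver-*ˡ k₁ _ M ⟩
      sumOver (λ e → k₁ * ∣ heavy ∩ e ∣) M  ≤⟨ sumOver-mono-≤ M (All.tabulate per-edge) ⟩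
      sumOver (λ e → ∣ I ∩ e ∣) M           ≡⟨ sym (∣p∩⋃Ss∣≡sumOver I (proj₂ M-matching)) ⟩
      ∣ I ∩ ⋃ M ∣                           ≤⟨ ∣p∩q∣≤∣p∣ I (⋃ M) ⟩
      ∣ I ∣                                 ∎
      where
      open ≤-Reasoning
      ∣heavy∩e∣≡ : ∀ e {c} → ∣ e ∩ heavy ∣ ≡ c → ∣ heavy ∩ e ∣ ≡ c
      ∣heavy∩e∣≡ e = trans (cong ∣_∣ (∩-comm heavy e))
      per-edge : ∀ {e} → e ∈ₗ M → k₁ * ∣ heavy ∩ e ∣ ≤ ∣ I ∩ e ∣
      per-edge {e} e∈M with ∣ e ∩ heavy ∣ in ∣e∩heavy∣≡ | at-most-one e∈M
      ... | 0 | _ = ≤-trans (≤-reflexive (trans (cong (k₁ *_) (∣heavy∩e∣≡ e ∣e∩heavy∣≡)) (*-zeroʳ k₁))) z≤n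
      ... | 1 | _ = begin
        k₁ * ∣ heavy ∩ e ∣   ≡⟨ cong (k₁ *_) (∣heavy∩e∣≡ e ∣e∩heavy∣≡) ⟩
        k₁ * 1               ≡⟨ *-identityʳ k₁ ⟩
        k₁                   ≡⟨ suc-injective (trans (cong (_+ ∣ e ∩ ∁ heavy ∣) (sym ∣e∩heavy∣≡))
                                  (trans (∣p∩q∣+∣p∩∁q∣≡∣p∣ e heavy) (uniform H e (All.lookup (proj₁ M-matching) e∈M)))) ⟨
        ∣ e ∩ ∁ heavy ∣      ≤⟨ p⊆q⇒∣p∣≤∣q∣ light⊆I∩e ⟩
        ∣ I ∩ e ∣            ∎
        where
        e-touching : e ∈ₗ filter (λ e → nonempty? (e ∩ heavy)) M
        e-touching = ∈-filter⁺ (λ e → nonempty? (e ∩ heavy)) e∈M (1≤∣p∣⇒Nonempty (e ∩ heavy) (≤-reflexive (sym ∣e∩heavy∣≡)))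
        light⊆I∩e : e ∩ ∁ heavy ⊆ I ∩ e
        light⊆I∩e y∈e∩light = x∈p∩q⁺ (q⊆p∪q U (touched ∩ ∁ heavy)
          (x∈p∩q⁺ (∈⋃⁺ e-touching (p∩q⊆p e (∁ heavy) y∈e∩light) , p∩q⊆q e (∁ heavy) y∈e∩light)) , p∩q⊆p e (∁ heavy) y∈e∩light)
      ... | suc (suc _) | s≤s ()

    Larger⊎independent : Larger H M ⊎ (Independent H I × k₁ * ∣ heavy ∣ ≤ ∣ I ∣)
    Larger⊎independent with anySubset? (λ f → (isEdge H f Bool.≟ true) ×-dec (f ⊆? I))
    ... | yes (f , f-edge , f⊆I) = inj₁ (edge-in-I⇒Larger f-edge f⊆I)
    ... | no no-edge-in-I with any? (λ e → 2 ≤? ∣ e ∩ heavy ∣) M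
    ...   | yes two = let (e , e∈M , 2≤∣e∩heavy∣) = find two in inj₁ (two-heavy⇒Larger e∈M 2≤∣e∩heavy∣)
    ...   | no no-two = inj₂ (independent , k₁*∣heavy∣≤∣I∣ (λ f-edge f⊆I → independent _ f-edge f⊆I) at-most-one)
      where
      independent : Independent H I
      independent f f-edge f⊆I = no-edge-in-I (f , f-edge , f⊆I)
      at-most-one : ∀ {e} → e ∈ₗ M → ∣ e ∩ heavy ∣ ≤ 1
      at-most-one e∈M = ≤-pred (≰⇒> λ 2≤ → no-two (Any.map (λ { refl → 2≤ }) e∈M))

    sumOver-deg≤ : All (λ S → ∣ S ∣ ≡ k₁) Ss → sumOver (deg H) Ss ≤ ∣ heavy ∣ * length Ss + n * suc k₁
    sumOver-deg≤ sizes = begin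
      sumOver (deg H) Ss
        ≤⟨ sumOver-mono-≤ Ss (All.map (λ ∣S∣≡k₁ → deg≤sumFin-extends H _ (cong suc ∣S∣≡k₁)) sizes) ⟩
      sumOver (λ S → sumFin (λ v → indicator (extends H S v))) Ss
        ≡⟨ sumOver-sumFin-comm (λ S v → indicator (extends H S v)) Ss ⟩
      sumFin load
        ≤⟨ sumFin-mono-≤ load≤ ⟩
      sumFin (λ v → indicator (isHeavy v) * length Ss + suc k₁)
        ≡⟨ sumFin-+ (λ v → indicator (isHeavy v) * length Ss) (λ _ → suc k₁) ⟩
      sumFin (λ v → indicator (isHeavy v) * length Ss) + sumFin {n} (λ _ → suc k₁)
        ≡⟨ cong₂ _+_ (sumFin-*ʳ (length Ss) (indicator ∘ isHeavy)) (sumFin-const n (suc k₁)) ⟩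
      sumFin (indicator ∘ isHeavy) * length Ss + n * suc k₁
        ≡⟨ cong (λ h → h * length Ss + n * suc k₁) (∣tabulate∣≡sumFin isHeavy) ⟨
      ∣ heavy ∣ * length Ss + n * suc k₁
        ∎
      where
      open ≤-Reasoning
      load≤ : ∀ v → load v ≤ indicator (isHeavy v) * length Ss + suc k₁
      load≤ v with isHeavy v in heavy?
      ... | true = ≤-trans (count≤length _ Ss) (≤-trans (≤-reflexive (sym (+-identityʳ _))) (m≤m+n _ _))
      ... | false = <⇒≤ (≰⇒> λ k≤load → subst T heavy? (≤⇒≤ᵇ k≤load))

  -- Growing a matching

  module _ {k₁ n : ℕ} (H : Hypergraph (suc k₁) n) where

    length≤n : ∀ {M} → IsMatching H M → length M ≤ n
    length≤n {M} (M-edges , M-disjoint) = begin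
      length M                     ≤⟨ length≤sum M-edges ⟩
      sumOver (λ e → ∣ ⊤ ∩ e ∣) M  ≡⟨ ∣p∩⋃Ss∣≡sumOver ⊤ M-disjoint ⟨
      ∣ ⊤ ∩ ⋃ M ∣                  ≤⟨ ∣p∣≤n (⊤ ∩ ⋃ M) ⟩
      n                            ∎
      where
      open ≤-Reasoning
      length≤sum : ∀ {es} → All (λ e → isEdge H e ≡ true) es → length es ≤ sumOver (λ e → ∣ ⊤ ∩ e ∣) es
      length≤sum [] = z≤n
      length≤sum {e ∷ _} (e-edge ∷ es-edges) =
        +-mono-≤ (≤-trans (s≤s z≤n) (≤-reflexive (sym (trans (cong ∣_∣ (∩-identityˡ e)) (uniform H e e-edge))))) (length≤sum es-edges)

  -- The codegree condition and 2kγ-extremality for γ = p / q, multiplied through by q.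

  HighCodegree : ∀ {k n} → Hypergraph k n → (p q : ℕ) → Set
  HighCodegree {k} {n} H p q = ∀ S → ∣ S ∣ ≡ k ∸ 1 → q * n ≤ k * q * deg H S + k * p * n

  Extremal : ∀ {k n} → Hypergraph k n → (p q : ℕ) → Set
  Extremal {k} {n} H p q = Σ (Subset n) λ I → Independent H I × (k ∸ 1) * n * q ≤ k * q * ∣ I ∣ + 2 * k * p * (k ∸ 1) * n

  enough-sets : ∀ j p q u → p ≤ q → q * ((2 + j) * (2 + j)) < p * u → ∃ λ m → (1 + j) * m ≤ u × (2 + j) * q ≤ m * p
  enough-sets j p q u p≤q q*k*k<p*u = m , k₁*m≤u , kq≤mp
    where
    m = u / (1 + j)
    r = u % (1 + j)
    k₁*m≤u : (1 + j) * m ≤ u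
    k₁*m≤u = subst (_≤ u) (*-comm m (1 + j)) (m/n*n≤m u (1 + j))
    kq≤mp : (2 + j) * q ≤ m * p
    kq≤mp with (2 + j) * q ≤? m * p
    ... | yes kq≤mp = kq≤mp
    ... | no kq≰mp = ⊥-elim (<⇒≱ q*k*k<p*u (≤-trans (m≤m+n (p * u) (1 + j)) (begin
      p * u + (1 + j)                           ≡⟨ cong (λ u → p * u + (1 + j)) (m≡m%n+[m/n]*n u (1 + j)) ⟩
      p * (r + m * (1 + j)) + (1 + j)           ≡⟨ solve 4 (λ p r m j → p :* (r :+ m :* (con 1 :+ j)) :+ (con 1 :+ j)
                                                          := p :* r :+ (con 1 :+ j) :* (con 1 :+ m :* p)) refl p r m j ⟩
      p * r + (1 + j) * (1 + m * p)             ≤⟨ +-mono-≤ (*-mono-≤ p≤q (≤-pred (m%n<n u (1 + j)))) (*-monoʳ-≤ (1 + j) (≰⇒> kq≰mp)) ⟩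
      q * j + (1 + j) * ((2 + j) * q)           ≤⟨ m≤m+n _ (2 * q) ⟩
      q * j + (1 + j) * ((2 + j) * q) + 2 * q   ≡⟨ solve 2 (λ q j → q :* j :+ (con 1 :+ j) :* ((con 2 :+ j) :* q) :+ con 2 :* q
                                                          := q :* ((con 2 :+ j) :* (con 2 :+ j))) refl q j ⟩
      q * ((2 + j) * (2 + j))                   ∎)))
      where open ≤-Reasoning

  extremal-arithmetic : ∀ k₁ m p q n b i D → 0 < q →
    m * (q * n) ≤ suc k₁ * q * D + m * (suc k₁ * p * n) → D ≤ b * m + n * suc k₁ →
    suc k₁ * q ≤ m * p → k₁ * b ≤ i → k₁ * n * q ≤ suc k₁ * q * i + 2 * suc k₁ * p * k₁ * n
  extremal-arithmetic k₁ zero p q n b i D 0<q _ _ kq≤0 _ = ⊥-elim (<⇒≱ (<-≤-trans 0<q (m≤n*m q (suc k₁))) kq≤0)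
  extremal-arithmetic k₁ (suc m′) p q n b i D _ degree-sum D≤ kq≤mp k₁b≤i = begin
    k₁ * n * q                              ≡⟨ solve 3 (λ k₁ n q → k₁ :* n :* q := k₁ :* (q :* n)) refl k₁ n q ⟩
    k₁ * (q * n)                            ≤⟨ *-monoʳ-≤ k₁ (*-cancelˡ-≤ m qn≤) ⟩
    k₁ * (K * q * b + 2 * K * p * n)        ≡⟨ solve 6 (λ k₁ K q b p n → k₁ :* (K :* q :* b :+ con 2 :* K :* p :* n)
                                                   := K :* q :* (k₁ :* b) :+ con 2 :* K :* p :* k₁ :* n) refl k₁ K q b p n ⟩
    K * q * (k₁ * b) + 2 * K * p * k₁ * n   ≤⟨ +-monoˡ-≤ _ (*-monoʳ-≤ (K * q) k₁b≤i) ⟩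
    K * q * i + 2 * K * p * k₁ * n          ∎
    where
    open ≤-Reasoning
    K = suc k₁
    m = suc m′
    qn≤ : m * (q * n) ≤ m * (K * q * b + 2 * K * p * n)
    qn≤ = begin
      m * (q * n)
        ≤⟨ degree-sum ⟩
      K * q * D + m * (K * p * n)
        ≤⟨ +-monoˡ-≤ _ (*-monoʳ-≤ (K * q) D≤) ⟩
      K * q * (b * m + n * K) + m * (K * p * n)
        ≡⟨ solve 6 (λ K b m n q p → K :* q :* (b :* m :+ n :* K) :+ m :* (K :* p :* n)
                                 := m :* (K :* q :* b) :+ (K :* q) :* (n :* K) :+ m :* (K :* p :* n)) refl K b m n q p ⟩
      m * (K * q * b) + (K * q) * (n * K) + m * (K * p * n)
        ≤⟨ +-monoˡ-≤ _ (+-monoʳ-≤ (m * (K * q * b)) (*-monoˡ-≤ (n * K) kq≤mp)) ⟩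
      m * (K * q * b) + (m * p) * (n * K) + m * (K * p * n)
        ≡⟨ solve 6 (λ K b m n q p → m :* (K :* q :* b) :+ (m :* p) :* (n :* K) :+ m :* (K :* p :* n)
                                 := m :* (K :* q :* b :+ con 2 :* K :* p :* n)) refl K b m n q p ⟩
      m * (K * q * b + 2 * K * p * n)
        ∎

  module _ {j n : ℕ} (H : Hypergraph (2 + j) n) {p q : ℕ} (0<q : 0 < q) (p≤q : p ≤ q)
           (high : HighCodegree H p q) (not-extremal : ¬ Extremal H p q) where

    uncovered-small⊎Larger : ∀ {M} → IsMatching H M → p * ∣ ∁ (⋃ M) ∣ ≤ q * ((2 + j) * (2 + j)) ⊎ Larger H M
    uncovered-small⊎Larger {M} M-matching with p * ∣ ∁ (⋃ M) ∣ ≤? q * ((2 + j) * (2 + j))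
    ... | yes small = inj₁ small
    ... | no large with enough-sets j p q _ p≤q (≰⇒> large)
    ...   | m , k₁m≤∣U∣ , kq≤mp with disjoint-subsets-of-size (1 + j) m (∁ (⋃ M)) k₁m≤∣U∣
    ...     | Ss , refl , Ss-disjoint , sizes , Ss-uncovered with Heavy.Larger⊎independent H M-matching Ss-disjoint Ss-uncovered
    ...       | inj₁ larger = inj₂ larger
    ...       | inj₂ (I-independent , k₁∣heavy∣≤∣I∣) =
      ⊥-elim (not-extremal (I , I-independent ,
        extremal-arithmetic (1 + j) (length Ss) p q n ∣ heavy ∣ ∣ I ∣ (sumOver (deg H) Ss) 0<q degree-sum
          (sumOver-deg≤ sizes) kq≤mp k₁∣heavy∣≤∣I∣))
      where
      open Heavy H M-matching Ss-disjoint Ss-uncovered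
      degree-sum : length Ss * (q * n) ≤ (2 + j) * q * sumOver (deg H) Ss + length Ss * ((2 + j) * p * n)
      degree-sum = subst (λ D → length Ss * (q * n) ≤ D + length Ss * ((2 + j) * p * n))
        (sym (sumOver-*ˡ ((2 + j) * q) (deg H) Ss))
        (length*≤sumOver+length* (λ S → (2 + j) * q * deg H S) (q * n) ((2 + j) * p * n) Ss (All.map (high _) sizes))

    grow : (fuel : ℕ) {M : List (Subset n)} → IsMatching H M → n < length M + fuel →
           ∃ λ M → IsMatching H M × p * uncovered M ≤ q * ((2 + j) * (2 + j))
    grow zero {M} M-matching n<|M| = ⊥-elim (<⇒≱ (subst (n <_) (+-identityʳ (length M)) n<|M|) (length≤n H M-matching))
    grow (suc fuel) {M} M-matching n<|M|+1+fuel with uncovered-small⊎Larger M-matching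
    ... | inj₁ small = M , M-matching , subst (λ u → p * u ≤ _) (∣∁p∣≡n∸∣p∣ (⋃ M)) small
    ... | inj₂ (M′ , M′-matching , |M′|≡1+|M|) =
      grow fuel M′-matching (subst (λ l → n < l + fuel) (sym |M′|≡1+|M|) (subst (n <_) (+-suc (length M) fuel) n<|M|+1+fuel))

  near-perfect-matching : ∀ {k n} (H : Hypergraph k n) {p q} → 2 ≤ k → 0 < q → HighCodegree H p q → ¬ Extremal H p q →
                          ∃ λ M → IsMatching H M × p * uncovered M ≤ q * (k * k)
  near-perfect-matching {suc zero} H (s≤s ())
  near-perfect-matching {suc (suc j)} {n} H {p} {q} _ 0<q high not-extremal with q ≤? 2 * (2 + j) * p
  -- If 2kγ ≥ 1, the empty set is already large enough to make H extremal.
  ... | yes q≤2kp = ⊥-elim (not-extremal (⊥ , ∅-independent , ∅-large))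
    where
    open ≤-Reasoning
    ∅-independent : Independent H ⊥
    ∅-independent e e-edge e⊆∅ = case k≤0 of λ ()
      where
      k≤0 : 2 + j ≤ 0
      k≤0 = begin
        2 + j       ≡⟨ uniform H e e-edge ⟨
        ∣ e ∣       ≤⟨ p⊆q⇒∣p∣≤∣q∣ e⊆∅ ⟩
        ∣ ⊥ {n} ∣   ≡⟨ ∣⊥∣≡0 n ⟩
        0           ∎
    ∅-large : (1 + j) * n * q ≤ (2 + j) * q * ∣ ⊥ {n} ∣ + 2 * (2 + j) * p * (1 + j) * n
    ∅-large rewrite ∣⊥∣≡0 n = begin
      (1 + j) * n * q                            ≤⟨ *-monoʳ-≤ ((1 + j) * n) q≤2kp ⟩
      (1 + j) * n * (2 * (2 + j) * p)            ≡⟨ solve 4 (λ j n p q → (con 1 :+ j) :* n :* (con 2 :* (con 2 :+ j) :* p)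
                                                      := (con 2 :+ j) :* q :* con 0 :+ con 2 :* (con 2 :+ j) :* p :* (con 1 :+ j) :* n)
                                                      refl j n p q ⟩
      (2 + j) * q * 0 + 2 * (2 + j) * p * (1 + j) * n ∎
  ... | no q≰2kp = grow H 0<q p≤q high not-extremal (suc n) ([] , []) ≤-refl
    where
    p≤q : p ≤ q
    p≤q = ≤-trans (m≤n*m p (2 * (2 + j))) (<⇒≤ (≰⇒> q≰2kp))

open import Defs
open import Data.Nat using (ℕ; _∸_)
import Data.Nat as ℕ
import Data.Nat.Properties as ℕₚ
open import Data.Integer as ℤ using (+_; -[1+_])
import Data.Integer.Properties as ℤ
open import Data.Rational using (ℚ; 0ℚ; 1ℚ; _<_; _≤_; _*_; _-_; _+_; -_; mkℚ; toℚᵘ; Positive; NonNegative; *≤*)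
open import Data.Rational.Properties
  using (normalize-coprime; toℚᵘ-injective; toℚᵘ-homo-+; toℚᵘ-homo-*; +-monoˡ-≤; *-monoʳ-≤-nonNeg; *-cancelʳ-≤-pos;
         <⇒≤; module ≤-Reasoning)
import Data.Rational.Unnormalised as ℚᵘ
import Data.Rational.Unnormalised.Properties as ℚᵘ
open import Data.Rational.Solver using (module +-*-Solver)
open +-*-Solver using (solve; _:+_; _:*_; _:-_; _:=_; con)
open import Data.Nat.Coprimality as Coprime using (1-coprimeTo)
open import Data.Fin.Subset using (Subset; ∣_∣)
open import Data.List using (List)
open import Data.Product using (Σ; ∃; _×_; _,_)
open import Relation.Binary.PropositionalEquality using (_≡_; refl; sym; trans; cong; cong₂; subst₂)
open import Relation.Nullary using (¬_)
open Matchings using (HighCodegree; Extremal; near-perfect-matching)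

ℕ→ℚ≡mkℚ : ∀ a → ℕ→ℚ a ≡ mkℚ (+ a) 0 (Coprime.sym (1-coprimeTo a))
ℕ→ℚ≡mkℚ a = normalize-coprime (Coprime.sym (1-coprimeTo a))

toℚᵘ-ℕ→ℚ : ∀ a → toℚᵘ (ℕ→ℚ a) ≡ ℚᵘ.mkℚᵘ (+ a) 0
toℚᵘ-ℕ→ℚ a rewrite ℕ→ℚ≡mkℚ a = refl

ℕ→ℚ-homo-+ : ∀ a b → ℕ→ℚ (a ℕ.+ b) ≡ ℕ→ℚ a + ℕ→ℚ b
ℕ→ℚ-homo-+ a b = toℚᵘ-injective (ℚᵘ.≃-trans (ℚᵘ.≃-reflexive (toℚᵘ-ℕ→ℚ (a ℕ.+ b)))
  (ℚᵘ.≃-trans (ℚᵘ.*≡* cross) (ℚᵘ.≃-sym (ℚᵘ.≃-trans (toℚᵘ-homo-+ (ℕ→ℚ a) (ℕ→ℚ b))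
    (ℚᵘ.≃-reflexive (cong₂ ℚᵘ._+_ (toℚᵘ-ℕ→ℚ a) (toℚᵘ-ℕ→ℚ b)))))))
  where
  cross : + (a ℕ.+ b) ℤ.* + 1 ≡ (+ a ℤ.* + 1 ℤ.+ + b ℤ.* + 1) ℤ.* + 1
  cross rewrite ℤ.*-identityʳ (+ (a ℕ.+ b)) | ℤ.*-identityʳ (+ a) | ℤ.*-identityʳ (+ b)
              | ℤ.*-identityʳ (+ a ℤ.+ + b) = ℤ.pos-+ a b

ℕ→ℚ-homo-* : ∀ a b → ℕ→ℚ (a ℕ.* b) ≡ ℕ→ℚ a * ℕ→ℚ b
ℕ→ℚ-homo-* a b = toℚᵘ-injective (ℚᵘ.≃-trans (ℚᵘ.≃-reflexive (toℚᵘ-ℕ→ℚ (a ℕ.* b)))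
  (ℚᵘ.≃-trans (ℚᵘ.*≡* cross) (ℚᵘ.≃-sym (ℚᵘ.≃-trans (toℚᵘ-homo-* (ℕ→ℚ a) (ℕ→ℚ b))
    (ℚᵘ.≃-reflexive (cong₂ ℚᵘ._*_ (toℚᵘ-ℕ→ℚ a) (toℚᵘ-ℕ→ℚ b)))))))
  where
  cross : + (a ℕ.* b) ℤ.* + 1 ≡ (+ a ℤ.* + b) ℤ.* + 1
  cross rewrite ℤ.*-identityʳ (+ (a ℕ.* b)) | ℤ.*-identityʳ (+ a ℤ.* + b) = ℤ.pos-* a b

ℕ→ℚ-homo-*₃ : ∀ a b c → ℕ→ℚ (a ℕ.* b ℕ.* c) ≡ ℕ→ℚ a * ℕ→ℚ b * ℕ→ℚ c
ℕ→ℚ-homo-*₃ a b c = trans (ℕ→ℚ-homo-* (a ℕ.* b) c) (cong (_* ℕ→ℚ c) (ℕ→ℚ-homo-* a b))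

ℕ→ℚ-mono-≤ : ∀ {a b} → a ℕ.≤ b → ℕ→ℚ a ≤ ℕ→ℚ b
ℕ→ℚ-mono-≤ {a} {b} a≤b rewrite ℕ→ℚ≡mkℚ a | ℕ→ℚ≡mkℚ b =
  *≤* (subst₂ ℤ._≤_ (sym (ℤ.*-identityʳ (+ a))) (sym (ℤ.*-identityʳ (+ b))) (ℤ.+≤+ a≤b))

ℕ→ℚ-cancel-≤ : ∀ {a b} → ℕ→ℚ a ≤ ℕ→ℚ b → a ℕ.≤ b
ℕ→ℚ-cancel-≤ {a} {b} a≤b rewrite ℕ→ℚ≡mkℚ a | ℕ→ℚ≡mkℚ b with a≤b
... | *≤* a*1≤b*1 = ℤ.drop‿+≤+ (subst₂ ℤ._≤_ (ℤ.*-identityʳ (+ a)) (ℤ.*-identityʳ (+ b)) a*1≤b*1)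

ℕ→ℚ-nonNeg : ∀ a → NonNegative (ℕ→ℚ a)
ℕ→ℚ-nonNeg a rewrite ℕ→ℚ≡mkℚ a = _

ℕ→ℚ-suc-pos : ∀ a → Positive (ℕ→ℚ (ℕ.suc a))
ℕ→ℚ-suc-pos a rewrite ℕ→ℚ≡mkℚ (ℕ.suc a) = _

nonNegative-ratio : ∀ {γ} → 0ℚ ≤ γ → ∃ λ p → ∃ λ q′ → γ * ℕ→ℚ (ℕ.suc q′) ≡ ℕ→ℚ p
nonNegative-ratio {γ@(mkℚ (+ p) q′ _)} _ =
  p , q′ , toℚᵘ-injective (ℚᵘ.≃-trans (toℚᵘ-homo-* γ (ℕ→ℚ (ℕ.suc q′)))
             (ℚᵘ.≃-trans (ℚᵘ.≃-reflexive (cong (toℚᵘ γ ℚᵘ.*_) (toℚᵘ-ℕ→ℚ (ℕ.suc q′))))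
               (ℚᵘ.≃-trans (ℚᵘ.*≡* cross) (ℚᵘ.≃-reflexive (sym (toℚᵘ-ℕ→ℚ p))))))
  where
  cross : (+ p ℤ.* + ℕ.suc q′) ℤ.* + 1 ≡ + p ℤ.* + ℕ.suc (q′ ℕ.* 1)
  cross rewrite ℕₚ.*-identityʳ q′ = ℤ.*-identityʳ _
nonNegative-ratio {mkℚ -[1+ _ ] _ _} (*≤* ())


module _ {k n : ℕ} (H : Hypergraph k n) {γ : ℚ} {p q′ : ℕ} (γq≡p : γ * ℕ→ℚ (ℕ.suc q′) ≡ ℕ→ℚ p) where

  private
    q = ℕ.suc q′
    Q = ℕ→ℚ q
    P = ℕ→ℚ p
    K = ℕ→ℚ k
    N = ℕ→ℚ n

  open ≤-Reasoning

  HighCodegree-fromℚ : (∀ (S : Subset n) → ∣ S ∣ ≡ k ∸ 1 → N - K * γ * N ≤ K * ℕ→ℚ (deg H S)) → HighCodegree H p q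
  HighCodegree-fromℚ codegree S ∣S∣≡k-1 = ℕ→ℚ-cancel-≤ (begin
    ℕ→ℚ (q ℕ.* n)                          ≡⟨ ℕ→ℚ-homo-* q n ⟩
    Q * N                                   ≡⟨ solve 4 (λ N K γ Q → Q :* N := (N :- K :* γ :* N) :* Q :+ K :* (γ :* Q) :* N) refl N K γ Q ⟩
    (N - K * γ * N) * Q + K * (γ * Q) * N    ≤⟨ +-monoˡ-≤ (K * (γ * Q) * N) (*-monoʳ-≤-nonNeg Q {{ℕ→ℚ-nonNeg q}} (codegree S ∣S∣≡k-1)) ⟩
    K * D * Q + K * (γ * Q) * N              ≡⟨ cong (λ γQ → K * D * Q + K * γQ * N) γq≡p ⟩
    K * D * Q + K * P * N                    ≡⟨ cong (_+ K * P * N) (solve 3 (λ K D Q → K :* D :* Q := K :* Q :* D) refl K D Q) ⟩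
    K * Q * D + K * P * N                    ≡⟨ cong₂ _+_ (ℕ→ℚ-homo-*₃ k q (deg H S)) (ℕ→ℚ-homo-*₃ k p n) ⟨
    ℕ→ℚ (k ℕ.* q ℕ.* deg H S) + ℕ→ℚ (k ℕ.* p ℕ.* n) ≡⟨ ℕ→ℚ-homo-+ (k ℕ.* q ℕ.* deg H S) (k ℕ.* p ℕ.* n) ⟨
    ℕ→ℚ (k ℕ.* q ℕ.* deg H S ℕ.+ k ℕ.* p ℕ.* n) ∎)
    where D = ℕ→ℚ (deg H S)

  ¬Extremal-fromℚ : ¬ (Σ (Subset n) λ I → Independent H I × (1ℚ - ℕ→ℚ 2 * K * γ) * ℕ→ℚ (k ∸ 1) * N ≤ K * ℕ→ℚ ∣ I ∣) →
                 ¬ Extremal H p q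
  ¬Extremal-fromℚ non-extremal (I , I-independent , scaled) =
    non-extremal (I , I-independent , *-cancelʳ-≤-pos Q {{ℕ→ℚ-suc-pos q′}} (begin
      (1ℚ - T * K * γ) * K₁ * N * Q
        ≡⟨ solve 6 (λ T K γ K₁ N Q → (con 1ℚ :- T :* K :* γ) :* K₁ :* N :* Q
                                  := K₁ :* N :* Q :- T :* K :* (γ :* Q) :* K₁ :* N) refl T K γ K₁ N Q ⟩
      K₁ * N * Q - T * K * (γ * Q) * K₁ * N
        ≡⟨ cong (λ γQ → K₁ * N * Q - T * K * γQ * K₁ * N) γq≡p ⟩
      K₁ * N * Q - T * K * P * K₁ * N
        ≤⟨ +-monoˡ-≤ (- (T * K * P * K₁ * N)) scaled′ ⟩
      K * Q * ∣I∣ + T * K * P * K₁ * N - T * K * P * K₁ * N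
        ≡⟨ solve 7 (λ T K P K₁ N Q i → K :* Q :* i :+ T :* K :* P :* K₁ :* N :- T :* K :* P :* K₁ :* N
                                    := K :* i :* Q) refl T K P K₁ N Q ∣I∣ ⟩
      K * ∣I∣ * Q
        ∎))
    where
    T = ℕ→ℚ 2
    K₁ = ℕ→ℚ (k ∸ 1)
    ∣I∣ = ℕ→ℚ ∣ I ∣
    scaled′ : K₁ * N * Q ≤ K * Q * ∣I∣ + T * K * P * K₁ * N
    scaled′ = subst₂ _≤_ (ℕ→ℚ-homo-*₃ (k ∸ 1) n q)
      (trans (ℕ→ℚ-homo-+ (k ℕ.* q ℕ.* ∣ I ∣) (2 ℕ.* k ℕ.* p ℕ.* (k ∸ 1) ℕ.* n))
        (cong₂ _+_ (ℕ→ℚ-homo-*₃ k q ∣ I ∣)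
          (trans (ℕ→ℚ-homo-* (2 ℕ.* k ℕ.* p ℕ.* (k ∸ 1)) n)
            (cong (_* N) (trans (ℕ→ℚ-homo-* (2 ℕ.* k ℕ.* p) (k ∸ 1)) (cong (_* K₁) (ℕ→ℚ-homo-*₃ 2 k p)))))))
      (ℕ→ℚ-mono-≤ scaled)

  uncovered-toℚ : ∀ u → p ℕ.* u ℕ.≤ q ℕ.* (k ℕ.* k) → γ * ℕ→ℚ u ≤ K * K
  uncovered-toℚ u pu≤qkk = *-cancelʳ-≤-pos Q {{ℕ→ℚ-suc-pos q′}} (begin
    γ * U * Q           ≡⟨ solve 3 (λ γ U Q → γ :* U :* Q := γ :* Q :* U) refl γ U Q ⟩
    γ * Q * U           ≡⟨ cong (_* U) γq≡p ⟩
    P * U               ≡⟨ ℕ→ℚ-homo-* p u ⟨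
    ℕ→ℚ (p ℕ.* u)       ≤⟨ ℕ→ℚ-mono-≤ pu≤qkk ⟩
    ℕ→ℚ (q ℕ.* (k ℕ.* k)) ≡⟨ trans (ℕ→ℚ-homo-* q (k ℕ.* k)) (cong (Q *_) (ℕ→ℚ-homo-* k k)) ⟩
    Q * (K * K)         ≡⟨ solve 2 (λ K Q → Q :* (K :* K) := K :* K :* Q) refl K Q ⟩
    K * K * Q           ∎)
    where U = ℕ→ℚ u

lemma1p7 : (k : ℕ) → 3 Data.Nat.≤ k → (γ : ℚ) → 0ℚ < γ →
    Σ ℕ λ n₀ → ∀ (n : ℕ) → n₀ Data.Nat.≤ n → (H : Hypergraph k n) →
    (∀ (S : Subset n) → ∣ S ∣ ≡ k ∸ 1 →
    ℕ→ℚ n - ℕ→ℚ k * γ * ℕ→ℚ n ≤ ℕ→ℚ k * ℕ→ℚ (deg H S)) →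
    ¬ (Σ (Subset n) λ I → Independent H I ×
    (1ℚ - ℕ→ℚ 2 * ℕ→ℚ k * γ) * ℕ→ℚ (k ∸ 1) * ℕ→ℚ n ≤ ℕ→ℚ k * ℕ→ℚ ∣ I ∣) →
    Σ (List (Subset n)) λ M → IsMatching H M ×
    γ * ℕ→ℚ (uncovered M) ≤ ℕ→ℚ k * ℕ→ℚ k
lemma1p7 k 3≤k γ 0<γ with nonNegative-ratio (<⇒≤ 0<γ)
... | p , q′ , γq≡p = 0 , λ n _ H codegree non-extremal →
  let M , M-matching , p*uncovered≤q*k*k =
        near-perfect-matching H {p} {ℕ.suc q′} (ℕₚ.≤-trans (ℕₚ.n≤1+n 2) 3≤k) (ℕ.s≤s ℕ.z≤n)
          (HighCodegree-fromℚ H γq≡p codegree) (¬Extremal-fromℚ H γq≡p non-extremal)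
  in M , M-matching , uncovered-toℚ H {γ} {p} {q′} γq≡p (uncovered M) p*uncovered≤q*k*k
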